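{- For positive integers $r_1,\dots,r_t$, \[ \operatorname{BR}^2(\vee_{r_1},\dots,\vee_{r_t}) =\operatorname{BR}^2(\wedge_{r_1},\dots,\wedge_{r_t}) = \left\lceil \log_2\left(2 + \sum_{i=1}^t (r_i-1)\right)\right\rceil. \]
   Context: A 2-uniform pograph is a poset together with a set of edges, each a comparable pair. The $r$-cup $\vee_r$ is the comparability graph of the poset $\{x,y_1,\dots,y_r\}$ with $x\le y_i$ for all $i$ (edges $xy_i$); the $r$-cap $\wedge_r$ is the comparability graph of $\{y,x_1,\dots,x_r\}$ with $x_i\le y$ (edges $x_iy$). Given a coloring of the comparable pairs of a poset $Q$, a copy of $H$ in color $i$ is an injection $f:V(H)\to Q$ with $f(x)\le f(y)$ whenever $x\le y$ such that every edge of $H$ is mapped to a pair of color $i$. $\operatorname{BR}^2(G_1,\dots,G_t)$ is the least $N$ such that every coloring of the comparable pairs (2-chains) of the Boolean lattice $B_N$ with colors $\{1,\dots,t\}$ contains, for some $i$, a copy of $G_i$ in color $i$. -}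

module Defs where

open import Data.Nat using (ℕ; zero; suc; _+_; _∸_; _≤_; _<_)
open import Data.Fin using (Fin; zero; suc)
open import Data.Fin.Subset using (Subset; _⊆_)
open import Data.Product using (Σ; ∃; _×_; _,_)
open import Relation.Binary.PropositionalEquality using (_≡_; _≢_)
open import Data.Sum using (_⊎_)
open import Function.Definitions using (Injective)
open import Relation.Nullary using (¬_)

∑ : (t : ℕ) → (Fin t → ℕ) → ℕ
∑ zero    a = 0
∑ (suc t) a = a zero + ∑ t (λ i → a (suc i))

-- A 2-uniform pograph on the vertex set Fin n: a (partial order) relation
-- _≤_ and a set of edges (each edge a comparable pair u ≤ v).
record Pograph : Set₁ where
  field
    size : ℕ
    leq  : Fin size → Fin size → Set
    edge : Fin size → Fin size → Set

open Pograph public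

-- Boolean lattice B_N = subsets of Fin N ordered by inclusion.
-- A t-coloring of the comparable pairs (2-chains a ⊂ b) of B_N.
-- (Values on non-chains are irrelevant.)
Coloring : ℕ → ℕ → Set
Coloring N t = Subset N → Subset N → Fin t

CopyIn : ∀ {N t} → Coloring N t → Fin t → Pograph → Set
CopyIn {N} c i H =
  Σ (Fin (size H) → Subset N) λ f →
    Injective _≡_ _≡_ f
    × (∀ u v → leq H u v → f u ⊆ f v)
    × (∀ u v → edge H u v → c (f u) (f v) ≡ i)

Arrows : (N t : ℕ) → (Fin t → Pograph) → Set
Arrows N t G = ∀ (c : Coloring N t) → ∃ λ i → CopyIn c i (G i)

BR²≡ : (t : ℕ) → (Fin t → Pograph) → ℕ → Set
BR²≡ t G K = Arrows K t G × (∀ N → N < K → ¬ Arrows N t G)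

-- r-cup: poset {x, y_1..y_r} with x ≤ y_i; x = zero, y_j = suc j; edges x y_j.
cup : ℕ → Pograph
cup r = record
  { size = suc r
  ; leq  = λ u v → u ≡ v ⊎ u ≡ zero
  ; edge = λ u v → u ≡ zero × v ≢ zero
  }

-- r-cap: poset {y, x_1..x_r} with x_i ≤ y; y = zero, x_j = suc j; edges x_j y.
cap : ℕ → Pograph
cap r = record
  { size = suc r
  ; leq  = λ u v → u ≡ v ⊎ v ≡ zero
  ; edge = λ u v → u ≢ zero × v ≡ zero
  }

-- For cups: if 2 ^ N ≥ 2 + ∑ (r i ∸ 1), colour the 2 ^ N - 1 nonempty sets b by c (∅ , b);
-- by pigeonhole some colour i occurs on r i of them, and these are the tops of an i-coloured
-- cup with bottom ∅. If instead 2 ^ N ≤ 1 + ∑ (r i ∸ 1), list the nonempty sets in binary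
-- order, cut the list into consecutive blocks of sizes r i ∸ 1, and give (a , b) the colour
-- of the block containing b: the r i distinct tops of an i-coloured cup are nonempty and
-- would all lie in block i. Caps are cups for the colouring (a , b) ↦ c (∁ b , ∁ a).
module Submission where

open import Defs
open import Algebra.Properties.CommutativeSemigroup using (interchange)
open import Data.Bool using (if_then_else_)
open import Data.Fin using (Fin; zero; suc; toℕ; fromℕ<; inject≤; _↑ˡ_; _↑ʳ_; splitAt)
open import Data.Fin.Properties
  using (_≟_; toℕ<n; toℕ-injective; fromℕ<-injective; inject≤-injective; join-splitAt; injective⇒≤)
  renaming (suc-injective to Fin-suc-injective)
open import Data.Fin.Subset using (Subset; _⊆_; ∁; inside; outside) renaming (⊥ to ∅)
open import Data.Fin.Subset.Properties
  using (⊥⊆; ⊆-refl; ⊆-reflexive; ⊆-antisym; p⊆q⇒∁p⊇∁q; ∁p⊆∁q⇒p⊇q)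
open import Data.Nat
  using (ℕ; zero; suc; _+_; _∸_; _^_; _≤_; _<_; z≤n; s≤s; s≤s⁻¹; z<s; _<?_; ⌈_/2⌉; ⌊_/2⌋)
open import Data.Nat.Logarithm using (⌈log₂_⌉; ⌈log₂⌉-mono-≤; ⌈log₂2^n⌉≡n; ⌈log₂⌈n/2⌉⌉≡⌈log₂n⌉∸1)
open import Data.Nat.Properties hiding (_≟_)
open import Data.Product using (Σ; ∃; _×_; _,_; proj₁; proj₂; map; swap)
open import Data.Product.Properties using (Σ-≡,≡→≡)
open import Data.Sum using (inj₁; inj₂) renaming (map to ⊎-map)
open import Data.Vec using ([]; _∷_)
open import Function using (_∘_; id; flip)
open import Function.Definitions using (Injective)
open import Relation.Nullary using (¬_; yes; no; does; contradiction)
open import Relation.Binary.PropositionalEquality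

⌈log₂m⌉≤k⇒m≤2^k : ∀ k {m} → ⌈log₂ m ⌉ ≤ k → m ≤ 2 ^ k
⌈log₂m⌉≤k⇒m≤2^k zero {m} log≤0 with m ≤? 1
... | yes m≤1 = m≤1
... | no  m≰1 = contradiction (≤-trans 1≤log log≤0) λ ()
  where
  1≤log : 1 ≤ ⌈log₂ m ⌉
  1≤log = subst (_≤ ⌈log₂ m ⌉) (⌈log₂2^n⌉≡n 1) (⌈log₂⌉-mono-≤ (≰⇒> m≰1))
⌈log₂m⌉≤k⇒m≤2^k (suc k) {m} log≤1+k = begin
  m                   ≡⟨ ⌊n/2⌋+⌈n/2⌉≡n m ⟨
  ⌊ m /2⌋ + ⌈ m /2⌉   ≤⟨ +-monoˡ-≤ _ (⌊n/2⌋≤⌈n/2⌉ m) ⟩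
  ⌈ m /2⌉ + ⌈ m /2⌉   ≤⟨ +-mono-≤ half≤2^k half≤2^k ⟩
  2 ^ k + 2 ^ k       ≡⟨ cong (2 ^ k +_) (+-identityʳ (2 ^ k)) ⟨
  2 ^ suc k           ∎
  where
  open ≤-Reasoning
  half≤2^k : ⌈ m /2⌉ ≤ 2 ^ k
  half≤2^k = ⌈log₂m⌉≤k⇒m≤2^k k (subst (_≤ k) (sym (⌈log₂⌈n/2⌉⌉≡⌈log₂n⌉∸1 m)) (∸-monoˡ-≤ 1 log≤1+k))

n<⌈log₂m⌉⇒2^n<m : ∀ {n m} → n < ⌈log₂ m ⌉ → 2 ^ n < m
n<⌈log₂m⌉⇒2^n<m {n} {m} n<log = ≰⇒> λ m≤2^n →
  <⇒≱ n<log (subst (⌈log₂ m ⌉ ≤_) (⌈log₂2^n⌉≡n n) (⌈log₂⌉-mono-≤ m≤2^n))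

encode : ∀ {n} → Subset n → ℕ
encode []                    = 0
encode {suc n} (outside ∷ p) = encode p
encode {suc n} (inside  ∷ p) = 2 ^ n + encode p

decode : ∀ n → ℕ → Subset n
decode zero    _ = []
decode (suc n) k with k <? 2 ^ n
... | yes _ = outside ∷ decode n k
... | no  _ = inside  ∷ decode n (k ∸ 2 ^ n)

encode<2^n : ∀ {n} (p : Subset n) → encode p < 2 ^ n
encode<2^n []                    = s≤s z≤n
encode<2^n {suc n} (outside ∷ p) = <-≤-trans (encode<2^n p) (m≤m+n (2 ^ n) _)
encode<2^n {suc n} (inside  ∷ p) = +-monoʳ-< (2 ^ n) (<-≤-trans (encode<2^n p) (m≤m+n (2 ^ n) 0))

decode-encode : ∀ {n} (p : Subset n) → decode n (encode p) ≡ p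
decode-encode [] = refl
decode-encode {suc n} (outside ∷ p) with encode p <? 2 ^ n
... | yes _ = cong (outside ∷_) (decode-encode p)
... | no  ≮ = contradiction (encode<2^n p) ≮
decode-encode {suc n} (inside ∷ p) with 2 ^ n + encode p <? 2 ^ n
... | yes <2^n = contradiction <2^n (≤⇒≯ (m≤m+n (2 ^ n) (encode p)))
... | no  _ = cong (inside ∷_) (trans (cong (decode n) (m+n∸m≡n (2 ^ n) (encode p))) (decode-encode p))

encode-decode : ∀ n {k} → k < 2 ^ n → encode (decode n k) ≡ k
encode-decode zero    {zero}  _ = refl
encode-decode zero    {suc _} (s≤s ())
encode-decode (suc n) {k} k< with k <? 2 ^ n
... | yes k<2^n = encode-decode n k<2^n
... | no  k≮2^n = trans (cong (2 ^ n +_) (encode-decode n k∸2^n<2^n)) (m+[n∸m]≡n 2^n≤k)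
  where
  2^n≤k : 2 ^ n ≤ k
  2^n≤k = ≮⇒≥ k≮2^n
  k∸2^n<2^n : k ∸ 2 ^ n < 2 ^ n
  k∸2^n<2^n = <-≤-trans (∸-monoˡ-< k< 2^n≤k) (≤-reflexive (trans (m+n∸m≡n (2 ^ n) _) (+-identityʳ _)))

encode-injective : ∀ {n} → Injective _≡_ _≡_ (encode {n})
encode-injective {n} {p} {q} eq =
  trans (sym (decode-encode p)) (trans (cong (decode n) eq) (decode-encode q))

encode-∅ : ∀ n → encode (∅ {n}) ≡ 0
encode-∅ zero    = refl
encode-∅ (suc n) = encode-∅ n

δ : ∀ {t} → Fin t → Fin t → ℕ
δ i j = if does (i ≟ j) then 1 else 0

∑-0 : ∀ t → ∑ t (λ _ → 0) ≡ 0
∑-0 zero    = refl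
∑-0 (suc t) = ∑-0 t

∑-δ : ∀ {t} (i : Fin t) → ∑ t (δ i) ≡ 1
∑-δ {suc t} zero    = cong suc (∑-0 t)
∑-δ {suc t} (suc i) = ∑-δ i

∑-+ : ∀ t (a b : Fin t → ℕ) → ∑ t (λ i → a i + b i) ≡ ∑ t a + ∑ t b
∑-+ zero    a b = refl
∑-+ (suc t) a b = trans (cong (a zero + b zero +_) (∑-+ t (a ∘ suc) (b ∘ suc)))
  (interchange +-commutativeSemigroup (a zero) (b zero) (∑ t (a ∘ suc)) (∑ t (b ∘ suc)))

∑-< : ∀ t (a b : Fin t → ℕ) → ∑ t a < ∑ t b → ∃ λ i → a i < b i
∑-< (suc t) a b ∑a<∑b with a zero <? b zero
... | yes a₀<b₀ = zero , a₀<b₀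
... | no  a₀≮b₀ = map suc id (∑-< t (a ∘ suc) (b ∘ suc)
  (+-cancelˡ-< (a zero) _ _ (<-≤-trans ∑a<∑b (+-monoˡ-≤ _ (≮⇒≥ a₀≮b₀)))))

record DistinctPoints {A : Set} (k : ℕ) (P : A → Set) : Set where
  constructor distinctPoints
  field
    point           : Fin k → A
    point-injective : Injective _≡_ _≡_ point
    point-satisfies : ∀ j → P (point j)

noPoints : ∀ {A : Set} {P : A → Set} → DistinctPoints 0 P
noPoints = distinctPoints (λ ()) (λ { {()} }) (λ ())

consPoint : ∀ {n k} {P : Fin (suc n) → Set} →
  P zero → DistinctPoints k (P ∘ suc) → DistinctPoints (suc k) P
consPoint {n} {k} {P} P₀ (distinctPoints x x-inj Px) = distinctPoints x′ x′-inj Px′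
  where
  x′ : Fin (suc k) → Fin (suc n)
  x′ zero    = zero
  x′ (suc j) = suc (x j)
  x′-inj : Injective _≡_ _≡_ x′
  x′-inj {zero}  {zero}   _  = refl
  x′-inj {suc j} {suc j′} eq = cong suc (x-inj (Fin-suc-injective eq))
  Px′ : ∀ j → P (x′ j)
  Px′ zero    = P₀
  Px′ (suc j) = Px j

DistinctPoints-map : ∀ {A B : Set} {P : A → Set} {Q : B → Set} {k} →
  (f : ∀ {a} → P a → B) → (∀ {a a′} (p : P a) (p′ : P a′) → f p ≡ f p′ → a ≡ a′) →
  (∀ {a} (p : P a) → Q (f p)) → DistinctPoints k P → DistinctPoints k Q
DistinctPoints-map f f-inj fQ (distinctPoints x x-inj Px) =
  distinctPoints (λ j → f (Px j)) (λ eq → x-inj (f-inj (Px _) (Px _) eq)) (λ j → fQ (Px j))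

DistinctPoints-≤ : ∀ {A : Set} {P : A → Set} {k l} →
  k ≤ l → DistinctPoints l P → DistinctPoints k P
DistinctPoints-≤ k≤l (distinctPoints x x-inj Px) = distinctPoints
  (λ j → x (inject≤ j k≤l)) (λ eq → inject≤-injective k≤l k≤l _ _ (x-inj eq)) (λ j → Px _)

fibreSize : ∀ {n t} → (Fin n → Fin t) → Fin t → ℕ
fibreSize {n} col i = ∑ n (λ x → δ (col x) i)

∑-fibreSize : ∀ {n} t (col : Fin n → Fin t) → ∑ t (fibreSize col) ≡ n
∑-fibreSize {zero}  t col = ∑-0 t
∑-fibreSize {suc n} t col = begin
  ∑ t (fibreSize col)
    ≡⟨ ∑-+ t (δ (col zero)) (fibreSize (col ∘ suc)) ⟩
  ∑ t (δ (col zero)) + ∑ t (fibreSize (col ∘ suc))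
    ≡⟨ cong₂ _+_ (∑-δ (col zero)) (∑-fibreSize t (col ∘ suc)) ⟩
  suc n ∎
  where open ≡-Reasoning

fibre-points : ∀ {n t} (col : Fin n → Fin t) (i : Fin t) {k} → k ≤ fibreSize col i →
  DistinctPoints k (λ x → col x ≡ i)
fibre-points {zero} col i z≤n = noPoints
fibre-points {suc n} col i k≤ with col zero ≟ i
... | no _ = DistinctPoints-map (λ {x} _ → suc x) (λ _ _ → Fin-suc-injective) id
               (fibre-points (col ∘ suc) i k≤)
fibre-points {suc n} col i {zero}  _  | yes _       = noPoints
fibre-points {suc n} col i {suc k} k≤ | yes col₀≡i =
  consPoint col₀≡i (fibre-points (col ∘ suc) i (s≤s⁻¹ k≤))

pigeonhole-∑ : ∀ {n t} (m : Fin t → ℕ) (col : Fin n → Fin t) → ∑ t m < n →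
  ∃ λ i → DistinctPoints (suc (m i)) (λ x → col x ≡ i)
pigeonhole-∑ {n} {t} m col ∑m<n
  with ∑-< t m (fibreSize col) (subst (∑ t m <_) (sym (∑-fibreSize t col)) ∑m<n)
... | i , mᵢ<fibre = i , fibre-points col i mᵢ<fibre

blockOf : ∀ t (m : Fin t → ℕ) → Fin (∑ t m) → Σ (Fin t) (Fin ∘ m)
blockOf (suc t) m w with splitAt (m zero) w
... | inj₁ o  = zero , o
... | inj₂ w′ = map suc id (blockOf t (m ∘ suc) w′)

unblock : ∀ t (m : Fin t → ℕ) → Σ (Fin t) (Fin ∘ m) → Fin (∑ t m)
unblock (suc t) m (zero  , o) = o ↑ˡ ∑ t (m ∘ suc)
unblock (suc t) m (suc i , o) = m zero ↑ʳ unblock t (m ∘ suc) (i , o)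

unblock-blockOf : ∀ t (m : Fin t → ℕ) w → unblock t m (blockOf t m w) ≡ w
unblock-blockOf (suc t) m w with splitAt (m zero) w | join-splitAt (m zero) (∑ t (m ∘ suc)) w
... | inj₁ o  | joined = joined
... | inj₂ w′ | joined = trans (cong (m zero ↑ʳ_) (unblock-blockOf t (m ∘ suc) w′)) joined

blockOf-injective : ∀ t (m : Fin t → ℕ) → Injective _≡_ _≡_ (blockOf t m)
blockOf-injective t m {w} {w′} eq =
  trans (sym (unblock-blockOf t m w)) (trans (cong (unblock t m) eq) (unblock-blockOf t m w′))

block-points-≤ : ∀ {t m i k} → DistinctPoints k (λ w → proj₁ (blockOf t m w) ≡ i) → k ≤ m i
block-points-≤ {t} {m} {i} {k} (distinctPoints w w-inj wᵢ) = injective⇒≤ o-injective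
  where
  o : Fin k → Fin (m i)
  o j = subst (Fin ∘ m) (wᵢ j) (proj₂ (blockOf t m (w j)))
  blockOf-w : ∀ j → blockOf t m (w j) ≡ (i , o j)
  blockOf-w j = Σ-≡,≡→≡ (wᵢ j , refl)
  o-injective : Injective _≡_ _≡_ o
  o-injective {j} {j′} eq = w-inj (blockOf-injective t m
    (trans (blockOf-w j) (trans (cong (i ,_) eq) (sym (blockOf-w j′)))))

blockColour : ∀ t (m : Fin t → ℕ) → Fin t → ℕ → Fin t
blockColour t m i₀ w with w <? ∑ t m
... | yes w<∑ = proj₁ (blockOf t m (fromℕ< w<∑))
... | no  _   = i₀

blockColour-< : ∀ t (m : Fin t → ℕ) i₀ {w} (w<∑ : w < ∑ t m) →
  blockColour t m i₀ w ≡ proj₁ (blockOf t m (fromℕ< w<∑))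
blockColour-< t m i₀ {w} w<∑ with w <? ∑ t m
... | yes _  = refl
... | no  w≮ = contradiction w<∑ w≮

blockColour-points-≤ : ∀ {t m i₀ i k} →
  DistinctPoints k (λ w → w < ∑ t m × blockColour t m i₀ w ≡ i) → k ≤ m i
blockColour-points-≤ {t} {m} {i₀} {i} = block-points-≤ {t} {m} {i} ∘ DistinctPoints-map
  (λ (w<∑ , _) → fromℕ< w<∑)
  (λ (w<∑ , _) (w′<∑ , _) → fromℕ<-injective _ _ w<∑ w′<∑)
  (λ (w<∑ , wᵢ) → trans (sym (blockColour-< t m i₀ w<∑)) wᵢ)

record CupTop {N t} (c : Coloring N t) (i : Fin t) (a b : Subset N) : Set where
  field
    below    : a ⊆ b
    distinct : b ≢ a
    coloured : c a b ≡ i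

open CupTop

module _ {N t} {c : Coloring N t} {i : Fin t} {r : ℕ} where

  cup-copy : ∀ {a} → DistinctPoints r (CupTop c i a) → CopyIn c i (cup r)
  cup-copy {a} (distinctPoints b b-inj top) = f , f-inj , f-mono , f-colour
    where
    f : Fin (suc r) → Subset N
    f zero    = a
    f (suc j) = b j
    f-inj : Injective _≡_ _≡_ f
    f-inj {zero}  {zero}   _   = refl
    f-inj {zero}  {suc j}  a≡b = contradiction (sym a≡b) (distinct (top j))
    f-inj {suc j} {zero}   b≡a = contradiction b≡a (distinct (top j))
    f-inj {suc j} {suc j′} eq  = cong suc (b-inj eq)
    f-mono : ∀ u v → leq (cup r) u v → f u ⊆ f v
    f-mono u     .u      (inj₁ refl) = ⊆-refl
    f-mono .zero zero    (inj₂ refl) = ⊆-refl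
    f-mono .zero (suc j) (inj₂ refl) = below (top j)
    f-colour : ∀ u v → edge (cup r) u v → c (f u) (f v) ≡ i
    f-colour .zero zero    (refl , v≢0) = contradiction refl v≢0
    f-colour .zero (suc j) (refl , _)   = coloured (top j)

  cup-tops : CopyIn c i (cup r) → ∃ λ a → DistinctPoints r (CupTop c i a)
  cup-tops (f , f-inj , f-mono , f-colour) =
    f zero , distinctPoints (f ∘ suc) (Fin-suc-injective ∘ f-inj) top
    where
    top : ∀ j → CupTop c i (f zero) (f (suc j))
    top j = record
      { below    = f-mono zero (suc j) (inj₂ refl)
      ; distinct = (λ ()) ∘ f-inj {suc j} {zero}
      ; coloured = f-colour zero (suc j) (refl , λ ())
      }

cup-arrows : ∀ {N t} (r : Fin t → ℕ) → 2 + ∑ t (λ i → r i ∸ 1) ≤ 2 ^ N → Arrows N t (cup ∘ r)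
cup-arrows {N} {t} r 2+S≤2^N c = i , cup-copy (DistinctPoints-≤ (m≤n+m∸n (r i) 1) tops)
  where
  S : ℕ
  S = ∑ t (λ i → r i ∸ 1)
  top : Fin (suc S) → Subset N
  top w = decode N (suc (toℕ w))
  encode-top : ∀ w → encode (top w) ≡ suc (toℕ w)
  encode-top w = encode-decode N (<-≤-trans (s≤s (toℕ<n w)) 2+S≤2^N)
  top-injective : Injective _≡_ _≡_ top
  top-injective {w} {w′} eq = toℕ-injective (suc-injective
    (trans (sym (encode-top w)) (trans (cong encode eq) (encode-top w′))))
  top≢∅ : ∀ w → top w ≢ ∅
  top≢∅ w eq = 1+n≢0 (trans (sym (encode-top w)) (trans (cong encode eq) (encode-∅ N)))
  pigeon : ∃ λ i → DistinctPoints (suc (r i ∸ 1)) (λ w → c ∅ (top w) ≡ i)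
  pigeon = pigeonhole-∑ (λ i → r i ∸ 1) (λ w → c ∅ (top w)) ≤-refl
  i : Fin t
  i = proj₁ pigeon
  tops : DistinctPoints (suc (r i ∸ 1)) (CupTop c i ∅)
  tops = DistinctPoints-map (λ {w} _ → top w) (λ _ _ → top-injective)
    (λ {w} cᵢ → record { below = ⊥⊆ ; distinct = top≢∅ w ; coloured = cᵢ }) (proj₂ pigeon)

¬cup-arrows : ∀ {N t} → Fin t → (r : Fin t → ℕ) → (∀ i → 1 ≤ r i) →
  2 ^ N ≤ suc (∑ t (λ i → r i ∸ 1)) → ¬ Arrows N t (cup ∘ r)
¬cup-arrows {N} {t} i₀ r 1≤r 2^N≤1+S arrows =
  <⇒≱ (∸-monoʳ-< z<s (1≤r i)) (blockColour-points-≤ slots)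
  where
  m : Fin t → ℕ
  m i = r i ∸ 1
  colouring : Coloring N t
  colouring _ b = blockColour t m i₀ (encode b ∸ 1)
  found : ∃ λ i → CopyIn colouring i (cup (r i))
  found = arrows colouring
  i : Fin t
  i = proj₁ found
  1≤encode : ∀ {a b} → CupTop colouring i a b → 1 ≤ encode b
  1≤encode {a} {b} top = n≢0⇒n>0 λ encode≡0 →
    let b≡∅ = encode-injective (trans encode≡0 (sym (encode-∅ N)))
        a≡∅ = ⊆-antisym (subst (a ⊆_) b≡∅ (below top)) ⊥⊆
    in distinct top (trans b≡∅ (sym a≡∅))
  slots : DistinctPoints (r i) (λ w → w < ∑ t m × blockColour t m i₀ w ≡ i)
  slots = DistinctPoints-map (λ {b} _ → encode b ∸ 1)
    (λ top top′ eq → encode-injective (∸-cancelʳ-≡ (1≤encode top) (1≤encode top′) eq))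
    (λ {b} top → ∸-monoˡ-< (<-≤-trans (encode<2^n b) 2^N≤1+S) (1≤encode top) , coloured top)
    (proj₂ (cup-tops (proj₂ found)))

opposite : Pograph → Pograph
opposite G = record { size = size G ; leq = flip (leq G) ; edge = flip (edge G) }

dual : ∀ {N t} → Coloring N t → Coloring N t
dual c a b = c (∁ b) (∁ a)

∁-injective : ∀ {n} → Injective _≡_ _≡_ (∁ {n})
∁-injective eq = ⊆-antisym (∁p⊆∁q⇒p⊇q (⊆-reflexive (sym eq))) (∁p⊆∁q⇒p⊇q (⊆-reflexive eq))

copy-dual : ∀ {N t} (c : Coloring N t) {i G} → CopyIn (dual c) i G → CopyIn c i (opposite G)
copy-dual c (f , f-inj , f-mono , f-colour) =
  ∁ ∘ f , f-inj ∘ ∁-injective , (λ u v v≤u → p⊆q⇒∁p⊇∁q (f-mono v u v≤u)) , flip f-colour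

copy-weaken : ∀ {N t} (c : Coloring N t) {i} (H : Pograph)
  {L E : Fin (size H) → Fin (size H) → Set} →
  (∀ {u v} → leq H u v → L u v) → (∀ {u v} → edge H u v → E u v) →
  CopyIn c i (record { size = size H ; leq = L ; edge = E }) → CopyIn c i H
copy-weaken c H L⊇ E⊇ (f , f-inj , f-mono , f-colour) =
  f , f-inj , (λ u v → f-mono u v ∘ L⊇) , (λ u v → f-colour u v ∘ E⊇)

arrows-opposite : ∀ {N t} {G H : Fin t → Pograph} →
  (∀ (c : Coloring N t) i → CopyIn c i (opposite (G i)) → CopyIn c i (H i)) →
  Arrows N t G → Arrows N t H
arrows-opposite weaken arrows c with arrows (dual c)
... | i , copy = i , weaken c i (copy-dual c copy)

cup⇒cap : ∀ {N t} (r : Fin t → ℕ) → Arrows N t (cup ∘ r) → Arrows N t (cap ∘ r)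
cup⇒cap r = arrows-opposite λ c i → copy-weaken c (cap (r i)) (⊎-map sym id) swap

cap⇒cup : ∀ {N t} (r : Fin t → ℕ) → Arrows N t (cap ∘ r) → Arrows N t (cup ∘ r)
cap⇒cup r = arrows-opposite λ c i → copy-weaken c (cup (r i)) (⊎-map sym id) swap

BR²≡-transfer : ∀ {t} {G H : Fin t → Pograph} {K} →
  (∀ {N} → Arrows N t G → Arrows N t H) → (∀ {N} → Arrows N t H → Arrows N t G) →
  BR²≡ t G K → BR²≡ t H K
BR²≡-transfer G⇒H H⇒G (arrows , minimal) = G⇒H arrows , λ N N<K → minimal N N<K ∘ H⇒G

proposition3p4 : (t : ℕ) → 1 ≤ t → (r : Fin t → ℕ) → (∀ i → 1 ≤ r i) →
    BR²≡ t (λ i → cup (r i)) ⌈log₂ (2 + ∑ t (λ i → r i ∸ 1)) ⌉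
    × BR²≡ t (λ i → cap (r i)) ⌈log₂ (2 + ∑ t (λ i → r i ∸ 1)) ⌉
proposition3p4 t 1≤t r 1≤r = cups , BR²≡-transfer (cup⇒cap r) (cap⇒cup r) cups
  where
  S : ℕ
  S = ∑ t (λ i → r i ∸ 1)
  cups : BR²≡ t (cup ∘ r) ⌈log₂ (2 + S) ⌉
  cups = cup-arrows r (⌈log₂m⌉≤k⇒m≤2^k _ ≤-refl)
       , λ N N<K → ¬cup-arrows (fromℕ< 1≤t) r 1≤r (s≤s⁻¹ (n<⌈log₂m⌉⇒2^n<m N<K))
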